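{- For every type variable $X$ and types $A,B,C$ such that $\forall X.A\equiv B\Rightarrow C$, there exists a type $C'$ such that $C\equiv\forall X.C'$ and $A\equiv B\Rightarrow C'$.
   Context: Types: $A ::= X \mid A\Rightarrow A \mid A\wedge A \mid \forall X.A$, $X$ type variables, modulo $\alpha$-equivalence; $\Rightarrow$ associates to the right. Type isomorphism $\equiv$ is the smallest congruence on types containing: $A\wedge B\equiv B\wedge A$; $A\wedge(B\wedge C)\equiv(A\wedge B)\wedge C$; $A\Rightarrow(B\wedge C)\equiv(A\Rightarrow B)\wedge(A\Rightarrow C)$; $(A\wedge B)\Rightarrow C\equiv A\Rightarrow B\Rightarrow C$; $\forall X.(A\Rightarrow B)\equiv A\Rightarrow\forall X.B$ if $X\notin FTV(A)$; $\forall X.(A\wedge B)\equiv\forall X.A\wedge\forall X.B$. -}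

module Defs where

open import Data.Nat using (ℕ; zero; suc)
open import Data.Fin using (Fin; zero; suc)

-- Types  A ::= X | A ⇒ A | A ∧ A | ∀X.A  modulo α-equivalence,
-- represented with de Bruijn indices: Ty n = types whose free type
-- variables are among n variables (index 0 = innermost binder).
infixr 6 _⇒_
infixr 7 _∧_

data Ty (n : ℕ) : Set where
  var : Fin n → Ty n
  _⇒_ : Ty n → Ty n → Ty n
  _∧_ : Ty n → Ty n → Ty n
  ∀' : Ty (suc n) → Ty n

-- Renaming and weakening (inserting a fresh variable at index 0).
-- A type of the form  wk A  is exactly a type in which the variable 0
-- does not occur free.
ext : ∀ {m n} → (Fin m → Fin n) → Fin (suc m) → Fin (suc n)
ext ρ zero    = zero
ext ρ (suc i) = suc (ρ i)

rename : ∀ {m n} → (Fin m → Fin n) → Ty m → Ty n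
rename ρ (var i) = var (ρ i)
rename ρ (A ⇒ B) = rename ρ A ⇒ rename ρ B
rename ρ (A ∧ B) = rename ρ A ∧ rename ρ B
rename ρ (∀' A)  = ∀' (rename (ext ρ) A)

wk : ∀ {n} → Ty n → Ty (suc n)
wk = rename suc

infix 4 _≅_
data _≅_ : ∀ {n} → Ty n → Ty n → Set where
  refl≅  : ∀ {n} {A : Ty n} → A ≅ A
  sym≅   : ∀ {n} {A B : Ty n} → A ≅ B → B ≅ A
  trans≅ : ∀ {n} {A B C : Ty n} → A ≅ B → B ≅ C → A ≅ C
  ⇒-cong : ∀ {n} {A A' B B' : Ty n} → A ≅ A' → B ≅ B' → (A ⇒ B) ≅ (A' ⇒ B')
  ∧-cong : ∀ {n} {A A' B B' : Ty n} → A ≅ A' → B ≅ B' → (A ∧ B) ≅ (A' ∧ B')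
  ∀-cong : ∀ {n} {A A' : Ty (suc n)} → A ≅ A' → ∀' A ≅ ∀' A'
  comm     : ∀ {n} {A B : Ty n} → (A ∧ B) ≅ (B ∧ A)
  asso     : ∀ {n} {A B C : Ty n} → (A ∧ (B ∧ C)) ≅ ((A ∧ B) ∧ C)
  dist     : ∀ {n} {A B C : Ty n} → (A ⇒ (B ∧ C)) ≅ ((A ⇒ B) ∧ (A ⇒ C))
  curry    : ∀ {n} {A B C : Ty n} → ((A ∧ B) ⇒ C) ≅ (A ⇒ B ⇒ C)
  p-comm   : ∀ {n} {A : Ty n} {B : Ty (suc n)} → ∀' (wk A ⇒ B) ≅ (A ⇒ ∀' B)
  p-dist   : ∀ {n} {A B : Ty (suc n)} → ∀' (A ∧ B) ≅ (∀' A ∧ ∀' B)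

-- Every type is isomorphic to a non-empty conjunction of prime types H₁ ⇒ ⋯ ⇒ Hₖ ⇒ t, where t
-- is a variable or ∀X.p with p prime, and isomorphic types have prime factorisations that agree
-- up to a permutation of the factors and, recursively, of the hypotheses of each factor.  The
-- factors of B ⇒ C are those of C with the factors of B prepended as hypotheses; a factor of ∀X.A
-- is one of A with the hypotheses not mentioning X pulled out of the quantifier.  Matching the
-- factors of ∀X.A with those of B ⇒ C, each factor a of A and its partner c of C therefore satisfy
-- a ≅ B ⇒ D and c ≅ ∀X.D for D := (the remaining hypotheses of c) ⇒ (the part of a inside ∀X);
-- C' is the conjunction of these D.
module Submission where

open import Defs

open import Data.Nat using (ℕ; suc)
open import Data.Fin using (Fin; zero; suc)
open import Data.List using (List; []; _∷_; _++_; map; mapMaybe)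
open import Data.List.NonEmpty using (List⁺; _∷_; [_]; head; tail; toList; _⁺++⁺_) renaming (map to map⁺)
open import Data.List.Properties
  using (++-identityʳ; ++-assoc; map-++; map-∘; map-cong;
         mapMaybe-map; map-mapMaybe; mapMaybe-cong; mapMaybe-++; mapMaybe-just; mapMaybe-nothing)
open import Data.Maybe as M using (Maybe; just; nothing; maybe′; zipWith; zip)
open import Data.Maybe.Relation.Unary.All using (All; just; nothing; drop-just)
open import Data.Maybe.Relation.Binary.Pointwise as PW using (Pointwise; just; nothing)
open import Data.Product using (Σ; ∃; ∃₂; _×_; _,_)
open import Function using (id)
open import Relation.Binary.PropositionalEquality
  using (_≡_; refl; sym; trans; cong; cong₂; subst; subst₂; module ≡-Reasoning)
open import Relation.Binary.Reasoning.Syntax using (module ≃-syntax)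

private variable
  k m n : ℕ
  ρ : Fin m → Fin n
  σ σ' : Fin m → Maybe (Fin n)

module _ {A B : Set} where

  All≡-map : ∀ (f : A → B) {x m} → All (_≡ x) m → All (_≡ f x) (M.map f m)
  All≡-map f (just refl) = just refl
  All≡-map f nothing     = nothing

  Pointwise-map : ∀ {R : A → A → Set} {S : B → B → Set} {f g : A → B}
                → (∀ {x y} → R x y → S (f x) (g y))
                → ∀ {a b} → Pointwise R a b → Pointwise S (M.map f a) (M.map g b)
  Pointwise-map h (just r) = just (h r)
  Pointwise-map h nothing  = nothing

module _ {A B C : Set} where

  mapᴹ-∘-commute : ∀ {A' : Set} {f : A → B} {g : B → C} {h : A → A'} {k : A' → C}
                 → (∀ x → g (f x) ≡ k (h x)) → ∀ m → M.map g (M.map f m) ≡ M.map k (M.map h m)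
  mapᴹ-∘-commute e (just x) = cong just (e x)
  mapᴹ-∘-commute e nothing  = refl

  mapᴹ-zipWith : ∀ {A' B' C' : Set} {f : A → B → C} {g : A' → B' → C'}
                   {h : C → C'} {k : A → A'} {l : B → B'}
               → (∀ x y → h (f x y) ≡ g (k x) (l y))
               → ∀ a b → M.map h (zipWith f a b) ≡ zipWith g (M.map k a) (M.map l b)
  mapᴹ-zipWith e (just x) (just y) = cong just (e x y)
  mapᴹ-zipWith e (just x) nothing  = refl
  mapᴹ-zipWith e nothing  b        = refl

  All≡-zipWith : ∀ (f : A → B → C) {x y a b} → All (_≡ x) a → All (_≡ y) b → All (_≡ f x y) (zipWith f a b)
  All≡-zipWith f (just refl) (just refl) = just refl
  All≡-zipWith f (just refl) nothing     = nothing
  All≡-zipWith f nothing     _           = nothing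

  Pointwise-zipWith : ∀ {R : A → A → Set} {S : B → B → Set} {T : C → C → Set} {f g : A → B → C}
                    → (∀ {x x' y y'} → R x x' → S y y' → T (f x y) (g x' y'))
                    → ∀ {a a' b b'} → Pointwise R a a' → Pointwise S b b'
                    → Pointwise T (zipWith f a b) (zipWith g a' b')
  Pointwise-zipWith h (just r) (just s) = just (h r s)
  Pointwise-zipWith h (just r) nothing  = nothing
  Pointwise-zipWith h nothing  _        = nothing

whenNothing : {A B : Set} → Maybe B → A → Maybe A
whenNothing m x = maybe′ (λ _ → nothing) (just x) m

whenNothing-cong : ∀ {A B : Set} {R : A → A → Set} {S : B → B → Set} {m m' x y}
                 → Pointwise S m m' → R x y → Pointwise R (whenNothing m x) (whenNothing m' y)
whenNothing-cong (just _) r = nothing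
whenNothing-cong nothing  r = just r

whenNothing-map : ∀ {A A' B B' : Set} (f : B → B') (g : A → A') m x
                → whenNothing (M.map f m) (g x) ≡ M.map g (whenNothing m x)
whenNothing-map f g (just y) x = refl
whenNothing-map f g nothing  x = refl

-- Permutations up to a relation

data Select {A : Set} (y : A) : List A → List A → Set where
  here  : ∀ {ys} → Select y (y ∷ ys) ys
  there : ∀ {x ys zs} → Select y ys zs → Select y (x ∷ ys) (x ∷ zs)

data Perm {A B : Set} (R : A → B → Set) : List A → List B → Set where
  []   : Perm R [] []
  cons : ∀ {x y xs ys ys'} → R x y → Select y ys ys' → Perm R xs ys' → Perm R (x ∷ xs) ys

module _ {A : Set} where

  Select-swap : ∀ {x y : A} {xs ys zs} → Select x xs ys → Select y ys zs
              → ∃ λ ws → Select y xs ws × Select x ws zs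
  Select-swap here      t         = _ , there t , here
  Select-swap (there s) here      = _ , here , s
  Select-swap (there s) (there t) with Select-swap s t
  ... | _ , s' , t' = _ , there s' , there t'

  Select-++ˡ : ∀ {y : A} {xs xs'} ys → Select y xs xs' → Select y (xs ++ ys) (xs' ++ ys)
  Select-++ˡ ys here      = here
  Select-++ˡ ys (there s) = there (Select-++ˡ ys s)

  Select-++ʳ : ∀ {y : A} {ys ys'} xs → Select y ys ys' → Select y (xs ++ ys) (xs ++ ys')
  Select-++ʳ []       s = s
  Select-++ʳ (x ∷ xs) s = there (Select-++ʳ xs s)

module _ {A B : Set} {R : A → B → Set} where

  Perm-select : ∀ {x xs xs' zs} → Select x xs xs' → Perm R xs zs
              → ∃₂ λ z zs' → Select z zs zs' × R x z × Perm R xs' zs'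
  Perm-select here      (cons r s p) = _ , _ , s , r , p
  Perm-select (there t) (cons r s p) with Perm-select t p
  ... | z , _ , s' , r' , p' with Select-swap s s'
  ...   | _ , s″ , t″ = z , _ , s″ , r' , cons r t″ p'

  Perm-insert : ∀ {x y xs xs' ys} → Select x xs xs' → R x y → Perm R xs' ys → Perm R xs (y ∷ ys)
  Perm-insert here      r p             = cons r here p
  Perm-insert (there s) r (cons r' t p) = cons r' (there t) (Perm-insert s r p)

  Perm-++ : ∀ {xs xs' ys ys'} → Perm R xs xs' → Perm R ys ys' → Perm R (xs ++ ys) (xs' ++ ys')
  Perm-++             []           q = q
  Perm-++ {ys' = ys'} (cons r s p) q = cons r (Select-++ˡ ys' s) (Perm-++ p q)

  Perm-∷-target : ∀ {x xs ys} → Perm R (x ∷ xs) ys → ∃₂ λ y ys' → ys ≡ y ∷ ys'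
  Perm-∷-target (cons r here      p) = _ , _ , refl
  Perm-∷-target (cons r (there s) p) = _ , _ , refl

module _ {A : Set} {R : A → A → Set} where

  Perm-refl : (∀ x → R x x) → ∀ xs → Perm R xs xs
  Perm-refl r []       = []
  Perm-refl r (x ∷ xs) = cons (r x) here (Perm-refl r xs)

  Perm-++-comm : (∀ x → R x x) → ∀ xs ys → Perm R (xs ++ ys) (ys ++ xs)
  Perm-++-comm r []       ys = subst (Perm R ys) (sym (++-identityʳ ys)) (Perm-refl r ys)
  Perm-++-comm r (x ∷ xs) ys = cons (r x) (Select-++ʳ ys here) (Perm-++-comm r xs ys)

module _ {A B : Set} (f : A → B) where

  Select-map : ∀ {y ys ys'} → Select y ys ys' → Select (f y) (map f ys) (map f ys')
  Select-map here      = here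
  Select-map (there s) = there (Select-map s)

  Select-map⁻ : ∀ {y} xs {ys'} → Select y (map f xs) ys'
              → ∃₂ λ x xs' → y ≡ f x × ys' ≡ map f xs' × Select x xs xs'
  Select-map⁻ (x ∷ xs) here      = x , xs , refl , refl , here
  Select-map⁻ (x ∷ xs) (there s) with Select-map⁻ xs s
  ... | x' , xs' , refl , refl , s' = x' , x ∷ xs' , refl , refl , there s'

module _ {A A' B B' : Set} {R : A → A' → Set} {S : B → B' → Set} (f : A → B) (g : A' → B') where

  Perm-map : (∀ {x y} → R x y → S (f x) (g y)) → ∀ {xs ys} → Perm R xs ys → Perm S (map f xs) (map g ys)
  Perm-map h []           = []
  Perm-map h (cons r s p) = cons (h r) (Select-map g s) (Perm-map h p)

  Perm-map⁻ : (∀ {x y} → S (f x) (g y) → R x y) → ∀ {xs ys} → Perm S (map f xs) (map g ys) → Perm R xs ys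
  Perm-map⁻ h {[]}     {[]} []           = []
  Perm-map⁻ h {x ∷ xs} {ys} (cons r s p) with Select-map⁻ g ys s
  ... | y , ys' , refl , refl , s' = cons (h r) s' (Perm-map⁻ h p)

module _ {A B : Set} where

  Select? : Maybe B → List B → List B → Set
  Select? = maybe′ Select _≡_

  -- mapMaybe f (x ∷ xs) unfolds to f x ∷? mapMaybe f xs.
  _∷?_ : Maybe B → List B → List B
  m ∷? ys = maybe′ _∷_ id m ys

  Select?-here : ∀ m ys → Select? m (m ∷? ys) ys
  Select?-here (just y) ys = here
  Select?-here nothing  ys = refl

  Select?-there : ∀ m n {ys ys'} → Select? m ys ys' → Select? m (n ∷? ys) (n ∷? ys')
  Select?-there (just y) (just x) s    = there s
  Select?-there (just y) nothing  s    = s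
  Select?-there nothing  (just x) refl = refl
  Select?-there nothing  nothing  refl = refl

  Select-mapMaybe : ∀ (f : A → Maybe B) {y xs xs'} → Select y xs xs'
                  → Select? (f y) (mapMaybe f xs) (mapMaybe f xs')
  Select-mapMaybe f {y} {xs' = xs'} here = Select?-here (f y) (mapMaybe f xs')
  Select-mapMaybe f {y} (there {x} s)    = Select?-there (f y) (f x) (Select-mapMaybe f s)

  module _ {R : A → A → Set} {S : B → B → Set} {f g : A → Maybe B} where

    Perm-∷? : ∀ {m m' ys ys' zs}
            → Pointwise S m m' → Select? m' ys ys' → Perm S zs ys' → Perm S (m ∷? zs) ys
    Perm-∷? (just r) s    p = cons r s p
    Perm-∷? nothing  refl p = p

    Perm-mapMaybe : (∀ {x y} → R x y → Pointwise S (f x) (g y))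
                  → ∀ {xs ys} → Perm R xs ys → Perm S (mapMaybe f xs) (mapMaybe g ys)
    Perm-mapMaybe h []           = []
    Perm-mapMaybe h (cons r s p) = Perm-∷? (h r) (Select-mapMaybe g s) (Perm-mapMaybe h p)

  traverse : (A → Maybe B) → List A → Maybe (List B)
  traverse f []       = just []
  traverse f (x ∷ xs) = zipWith _∷_ (f x) (traverse f xs)

  private
    Inserted : B × List B → List B → Set
    Inserted (y , ys') ys = Select y ys ys'

    zip-here : ∀ m ms → Pointwise Inserted (zip m ms) (zipWith _∷_ m ms)
    zip-here (just y) (just ys) = just here
    zip-here (just y) nothing   = nothing
    zip-here nothing  ms        = nothing

    zip-there : ∀ m ms ms' n → Pointwise Inserted (zip m ms) ms'
              → Pointwise Inserted (zip m (zipWith _∷_ n ms)) (zipWith _∷_ n ms')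
    zip-there (just y) ms        ms' nothing  _        = nothing
    zip-there (just y) (just ys) ms' (just x) (just s) = just (there s)
    zip-there (just y) nothing   ms' (just x) nothing  = nothing
    zip-there nothing  ms        ms' nothing  nothing  = nothing
    zip-there nothing  ms        ms' (just x) nothing  = nothing

    Select-traverse : ∀ (f : A → Maybe B) {y xs xs'} → Select y xs xs'
                    → Pointwise Inserted (zip (f y) (traverse f xs')) (traverse f xs)
    Select-traverse f {y} {xs' = xs'} here = zip-here (f y) (traverse f xs')
    Select-traverse f {y} (there {x} {ys} {zs} s) =
      zip-there (f y) (traverse f zs) (traverse f ys) (f x) (Select-traverse f s)

    traverse-cons : ∀ {S : B → B → Set} {m m' ms ms' ns}
                  → Pointwise S m m' → Pointwise (Perm S) ms ms' → Pointwise Inserted (zip m' ms') ns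
                  → Pointwise (Perm S) (zipWith _∷_ m ms) ns
    traverse-cons (just r) (just p) (just s) = just (cons r s p)
    traverse-cons (just r) nothing  nothing  = nothing
    traverse-cons nothing  _        nothing  = nothing

  Perm-traverse : ∀ {S : B → B → Set} {f g : A → Maybe B} {xs ys}
                → Perm (λ x y → Pointwise S (f x) (g y)) xs ys
                → Pointwise (Perm S) (traverse f xs) (traverse g ys)
  Perm-traverse         []           = just []
  Perm-traverse {g = g} (cons r s p) = traverse-cons r (Perm-traverse p) (Select-traverse g s)

-- Prime types

mutual
  data Prime (n : ℕ) : Set where
    _⇛_ : List (Prime n) → Tail n → Prime n

  data Tail (n : ℕ) : Set where
    atom : Fin n → Tail n
    ∀ᵖ   : Prime (suc n) → Tail n

infix 5 _⇛_

mutual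
  data _~_ {n : ℕ} : Prime n → Prime n → Set where
    ⇛-cong : ∀ {H H' t t'} → Perm _~_ H H' → t ~ᵗ t' → (H ⇛ t) ~ (H' ⇛ t')

  data _~ᵗ_ {n : ℕ} : Tail n → Tail n → Set where
    atom : ∀ {i} → atom i ~ᵗ atom i
    ∀ᵖ   : ∀ {p q} → p ~ q → ∀ᵖ p ~ᵗ ∀ᵖ q

infix 4 _~_ _~ᵗ_ _≈_

_≈_ : List (Prime n) → List (Prime n) → Set
_≈_ = Perm _~_

mutual
  ~-refl : (p : Prime n) → p ~ p
  ~-refl (H ⇛ t) = ⇛-cong (≈-refl H) (~ᵗ-refl t)

  ~ᵗ-refl : (t : Tail n) → t ~ᵗ t
  ~ᵗ-refl (atom i) = atom
  ~ᵗ-refl (∀ᵖ p)   = ∀ᵖ (~-refl p)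

  ≈-refl : ∀ (H : List (Prime n)) → H ≈ H
  ≈-refl []      = []
  ≈-refl (h ∷ H) = cons (~-refl h) here (≈-refl H)

mutual
  ~-sym : {p q : Prime n} → p ~ q → q ~ p
  ~-sym (⇛-cong h t) = ⇛-cong (≈-sym h) (~ᵗ-sym t)

  ~ᵗ-sym : {t u : Tail n} → t ~ᵗ u → u ~ᵗ t
  ~ᵗ-sym atom   = atom
  ~ᵗ-sym (∀ᵖ r) = ∀ᵖ (~-sym r)

  ≈-sym : ∀ {H H' : List (Prime n)} → H ≈ H' → H' ≈ H
  ≈-sym []           = []
  ≈-sym (cons r s p) = Perm-insert s (~-sym r) (≈-sym p)

mutual
  ~-trans : {p q r : Prime n} → p ~ q → q ~ r → p ~ r
  ~-trans (⇛-cong h t) (⇛-cong h' t') = ⇛-cong (≈-trans h h') (~ᵗ-trans t t')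

  ~ᵗ-trans : {t u v : Tail n} → t ~ᵗ u → u ~ᵗ v → t ~ᵗ v
  ~ᵗ-trans atom   atom    = atom
  ~ᵗ-trans (∀ᵖ r) (∀ᵖ r') = ∀ᵖ (~-trans r r')

  ≈-trans : ∀ {H H' H″ : List (Prime n)} → H ≈ H' → H' ≈ H″ → H ≈ H″
  ≈-trans []           [] = []
  ≈-trans (cons r s p) q with Perm-select s q
  ... | _ , _ , s' , r' , q' = cons (~-trans r r') s' (≈-trans p q')

≈-reflexive : ∀ {H H' : List (Prime n)} → H ≡ H' → H ≈ H'
≈-reflexive {H = H} refl = ≈-refl H

mutual
  ren : (Fin m → Fin n) → Prime m → Prime n
  ren ρ (H ⇛ t) = renL ρ H ⇛ renᵗ ρ t

  renL : (Fin m → Fin n) → List (Prime m) → List (Prime n)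
  renL ρ []      = []
  renL ρ (h ∷ H) = ren ρ h ∷ renL ρ H

  renᵗ : (Fin m → Fin n) → Tail m → Tail n
  renᵗ ρ (atom i) = atom (ρ i)
  renᵗ ρ (∀ᵖ p)   = ∀ᵖ (ren (ext ρ) p)

renL-map : ∀ (ρ : Fin m → Fin n) H → renL ρ H ≡ map (ren ρ) H
renL-map ρ []      = refl
renL-map ρ (h ∷ H) = cong (ren ρ h ∷_) (renL-map ρ H)

Select-renL : ∀ (ρ : Fin m → Fin n) {y H H'} → Select y H H' → Select (ren ρ y) (renL ρ H) (renL ρ H')
Select-renL ρ here      = here
Select-renL ρ (there s) = there (Select-renL ρ s)

mutual
  ren-cong : ∀ (ρ : Fin m → Fin n) {p q} → p ~ q → ren ρ p ~ ren ρ q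
  ren-cong ρ (⇛-cong h t) = ⇛-cong (renL-cong ρ h) (renᵗ-cong ρ t)

  renᵗ-cong : ∀ (ρ : Fin m → Fin n) {t u} → t ~ᵗ u → renᵗ ρ t ~ᵗ renᵗ ρ u
  renᵗ-cong ρ atom   = atom
  renᵗ-cong ρ (∀ᵖ r) = ∀ᵖ (ren-cong (ext ρ) r)

  renL-cong : ∀ (ρ : Fin m → Fin n) {H H'} → H ≈ H' → renL ρ H ≈ renL ρ H'
  renL-cong ρ []           = []
  renL-cong ρ (cons r s p) = cons (ren-cong ρ r) (Select-renL ρ s) (renL-cong ρ p)

ext? : (Fin m → Maybe (Fin n)) → Fin (suc m) → Maybe (Fin (suc n))
ext? σ zero    = just zero
ext? σ (suc i) = M.map suc (σ i)

ext?-ext : (∀ i → σ (ρ i) ≡ σ' i) → ∀ i → ext? σ (ext ρ i) ≡ ext? σ' i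
ext?-ext e zero    = refl
ext?-ext e (suc i) = cong (M.map suc) (e i)

ext-ext? : (∀ i → M.map ρ (σ i) ≡ σ' i) → ∀ i → M.map (ext ρ) (ext? σ i) ≡ ext? σ' i
ext-ext?         e zero    = refl
ext-ext? {σ = σ} e (suc i) = trans (mapᴹ-∘-commute (λ _ → refl) (σ i)) (cong (M.map suc) (e i))

ext?-just : (∀ i → σ i ≡ just i) → ∀ i → ext? σ i ≡ just i
ext?-just e zero    = refl
ext?-just e (suc i) = cong (M.map suc) (e i)

ext?-All : (∀ i → All (_≡ i) (σ i)) → ∀ i → All (_≡ i) (ext? σ i)
ext?-All e zero    = just refl
ext?-All e (suc i) = All≡-map suc (e i)

mutual
  pren : (Fin m → Maybe (Fin n)) → Prime m → Maybe (Prime n)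
  pren σ (H ⇛ t) = zipWith _⇛_ (prenL σ H) (prenᵗ σ t)

  prenL : (Fin m → Maybe (Fin n)) → List (Prime m) → Maybe (List (Prime n))
  prenL σ []      = just []
  prenL σ (h ∷ H) = zipWith _∷_ (pren σ h) (prenL σ H)

  prenᵗ : (Fin m → Maybe (Fin n)) → Tail m → Maybe (Tail n)
  prenᵗ σ (atom i) = M.map atom (σ i)
  prenᵗ σ (∀ᵖ p)   = M.map ∀ᵖ (pren (ext? σ) p)

prenL-traverse : ∀ (σ : Fin m → Maybe (Fin n)) H → prenL σ H ≡ traverse (pren σ) H
prenL-traverse σ []      = refl
prenL-traverse σ (h ∷ H) = cong (zipWith _∷_ (pren σ h)) (prenL-traverse σ H)

mutual
  pren-ren : (∀ i → σ (ρ i) ≡ σ' i) → ∀ p → pren σ (ren ρ p) ≡ pren σ' p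
  pren-ren e (H ⇛ t) = cong₂ (zipWith _⇛_) (prenL-ren e H) (prenᵗ-ren e t)

  prenL-ren : (∀ i → σ (ρ i) ≡ σ' i) → ∀ H → prenL σ (renL ρ H) ≡ prenL σ' H
  prenL-ren e []      = refl
  prenL-ren e (h ∷ H) = cong₂ (zipWith _∷_) (pren-ren e h) (prenL-ren e H)

  prenᵗ-ren : (∀ i → σ (ρ i) ≡ σ' i) → ∀ t → prenᵗ σ (renᵗ ρ t) ≡ prenᵗ σ' t
  prenᵗ-ren e (atom i) = cong (M.map atom) (e i)
  prenᵗ-ren e (∀ᵖ p)   = cong (M.map ∀ᵖ) (pren-ren (ext?-ext e) p)

mutual
  ren-pren : (∀ i → M.map ρ (σ i) ≡ σ' i) → ∀ p → M.map (ren ρ) (pren σ p) ≡ pren σ' p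
  ren-pren {σ = σ} e (H ⇛ t) =
    trans (mapᴹ-zipWith (λ _ _ → refl) (prenL σ H) (prenᵗ σ t))
          (cong₂ (zipWith _⇛_) (renL-pren e H) (renᵗ-pren e t))

  renL-pren : (∀ i → M.map ρ (σ i) ≡ σ' i) → ∀ H → M.map (renL ρ) (prenL σ H) ≡ prenL σ' H
  renL-pren         e []      = refl
  renL-pren {σ = σ} e (h ∷ H) =
    trans (mapᴹ-zipWith (λ _ _ → refl) (pren σ h) (prenL σ H))
          (cong₂ (zipWith _∷_) (ren-pren e h) (renL-pren e H))

  renᵗ-pren : (∀ i → M.map ρ (σ i) ≡ σ' i) → ∀ t → M.map (renᵗ ρ) (prenᵗ σ t) ≡ prenᵗ σ' t
  renᵗ-pren {σ = σ} e (atom i) = trans (mapᴹ-∘-commute (λ _ → refl) (σ i)) (cong (M.map atom) (e i))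
  renᵗ-pren {σ = σ} e (∀ᵖ p)   =
    trans (mapᴹ-∘-commute (λ _ → refl) (pren (ext? σ) p)) (cong (M.map ∀ᵖ) (ren-pren (ext-ext? e) p))

mutual
  pren-just : (∀ i → σ i ≡ just i) → ∀ p → pren σ p ≡ just p
  pren-just e (H ⇛ t) = cong₂ (zipWith _⇛_) (prenL-just e H) (prenᵗ-just e t)

  prenL-just : (∀ i → σ i ≡ just i) → ∀ H → prenL σ H ≡ just H
  prenL-just e []      = refl
  prenL-just e (h ∷ H) = cong₂ (zipWith _∷_) (pren-just e h) (prenL-just e H)

  prenᵗ-just : (∀ i → σ i ≡ just i) → ∀ t → prenᵗ σ t ≡ just t
  prenᵗ-just e (atom i) = cong (M.map atom) (e i)
  prenᵗ-just e (∀ᵖ p)   = cong (M.map ∀ᵖ) (pren-just (ext?-just e) p)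

mutual
  pren-All : (∀ i → All (_≡ i) (σ i)) → ∀ p → All (_≡ p) (pren σ p)
  pren-All e (H ⇛ t) = All≡-zipWith _⇛_ (prenL-All e H) (prenᵗ-All e t)

  prenL-All : (∀ i → All (_≡ i) (σ i)) → ∀ H → All (_≡ H) (prenL σ H)
  prenL-All e []      = just refl
  prenL-All e (h ∷ H) = All≡-zipWith _∷_ (pren-All e h) (prenL-All e H)

  prenᵗ-All : (∀ i → All (_≡ i) (σ i)) → ∀ t → All (_≡ t) (prenᵗ σ t)
  prenᵗ-All e (atom i) = All≡-map atom (e i)
  prenᵗ-All e (∀ᵖ p)   = All≡-map ∀ᵖ (pren-All (ext?-All e) p)

mutual
  pren-cong : ∀ (σ : Fin m → Maybe (Fin n)) {p q} → p ~ q → Pointwise _~_ (pren σ p) (pren σ q)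
  pren-cong σ (⇛-cong {H} {H'} h t) =
    Pointwise-zipWith ⇛-cong
      (subst₂ (Pointwise _≈_) (sym (prenL-traverse σ H)) (sym (prenL-traverse σ H'))
              (Perm-traverse (prenL-cong σ h)))
      (prenᵗ-cong σ t)

  -- Stated for the relation only, which keeps the recursion structural; Perm-traverse lifts it to prenL.
  prenL-cong : ∀ (σ : Fin m → Maybe (Fin n)) {H H'}
             → H ≈ H' → Perm (λ x y → Pointwise _~_ (pren σ x) (pren σ y)) H H'
  prenL-cong σ []           = []
  prenL-cong σ (cons r s p) = cons (pren-cong σ r) s (prenL-cong σ p)

  prenᵗ-cong : ∀ (σ : Fin m → Maybe (Fin n)) {t u} → t ~ᵗ u → Pointwise _~ᵗ_ (prenᵗ σ t) (prenᵗ σ u)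
  prenᵗ-cong σ atom   = PW.refl (~ᵗ-refl _)
  prenᵗ-cong σ (∀ᵖ r) = Pointwise-map ∀ᵖ (pren-cong (ext? σ) r)

unsuc : Fin (suc n) → Maybe (Fin n)
unsuc zero    = nothing
unsuc (suc i) = just i

strengthen : Prime (suc n) → Maybe (Prime n)
strengthen = pren unsuc

strengthen-cong : ∀ {p q : Prime (suc n)} → p ~ q → Pointwise _~_ (strengthen p) (strengthen q)
strengthen-cong = pren-cong unsuc

strengthen-wk : (p : Prime n) → strengthen (ren suc p) ≡ just p
strengthen-wk p = trans (pren-ren {σ' = just} (λ _ → refl) p) (pren-just (λ _ → refl) p)

strengthen-just : ∀ {p : Prime (suc n)} {q} → strengthen p ≡ just q → ren suc q ≡ p
strengthen-just {p = p} {q} e = drop-just (subst (All (_≡ p)) wk-strengthen (pren-All suc-unsuc p))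
  where
  suc-unsuc : ∀ i → All (_≡ i) (M.map suc (unsuc i))
  suc-unsuc zero    = nothing
  suc-unsuc (suc i) = just refl

  wk-strengthen : pren (λ i → M.map suc (unsuc i)) p ≡ just (ren suc q)
  wk-strengthen = trans (sym (ren-pren (λ _ → refl) p)) (cong (M.map (ren suc)) e)

strengthen-ren : ∀ (ρ : Fin m → Fin n) p → strengthen (ren (ext ρ) p) ≡ M.map (ren ρ) (strengthen p)
strengthen-ren ρ p = trans (pren-ren unsuc-ext p) (sym (ren-pren (λ _ → refl) p))
  where
  unsuc-ext : ∀ i → unsuc (ext ρ i) ≡ M.map ρ (unsuc i)
  unsuc-ext zero    = refl
  unsuc-ext (suc i) = refl

-- Normal forms

hoisted : List (Prime (suc n)) → List (Prime n)
hoisted = mapMaybe strengthen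

pinned : List (Prime (suc n)) → List (Prime (suc n))
pinned = mapMaybe (λ h → whenNothing (strengthen h) h)

quantify : Prime (suc n) → Prime n
quantify (H ⇛ t) = hoisted H ⇛ ∀ᵖ (pinned H ⇛ t)

assume : List (Prime n) → Prime n → Prime n
assume G (H ⇛ t) = (G ++ H) ⇛ t

-- The language has no unit type, so there is no empty conjunction: normal forms are non-empty.
nf : Ty n → List⁺ (Prime n)
nf (var i) = [ [] ⇛ atom i ]
nf (A ⇒ B) = map⁺ (assume (toList (nf A))) (nf B)
nf (A ∧ B) = nf A ⁺++⁺ nf B
nf (∀' A)  = map⁺ quantify (nf A)

hoisted-cong : ∀ {H H' : List (Prime (suc n))} → H ≈ H' → hoisted H ≈ hoisted H'
hoisted-cong = Perm-mapMaybe strengthen-cong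

pinned-cong : ∀ {H H' : List (Prime (suc n))} → H ≈ H' → pinned H ≈ pinned H'
pinned-cong = Perm-mapMaybe (λ r → whenNothing-cong (strengthen-cong r) r)

quantify-cong : ∀ {p q : Prime (suc n)} → p ~ q → quantify p ~ quantify q
quantify-cong (⇛-cong h t) = ⇛-cong (hoisted-cong h) (∀ᵖ (⇛-cong (pinned-cong h) t))

assume-cong : ∀ {G G' : List (Prime n)} {p q} → G ≈ G' → p ~ q → assume G p ~ assume G' q
assume-cong g (⇛-cong h t) = ⇛-cong (Perm-++ g h) t

map-∘-commute : ∀ {A B B' C : Set} {f : B → C} {g : A → B} {h : B' → C} {k : A → B'}
              → (∀ x → f (g x) ≡ h (k x)) → ∀ xs → map f (map g xs) ≡ map h (map k xs)
map-∘-commute e xs = trans (sym (map-∘ xs)) (trans (map-cong e xs) (map-∘ xs))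

hoisted-ren : ∀ (ρ : Fin m → Fin n) H → hoisted (renL (ext ρ) H) ≡ renL ρ (hoisted H)
hoisted-ren ρ H = begin
  hoisted (renL (ext ρ) H)                          ≡⟨ cong hoisted (renL-map (ext ρ) H) ⟩
  mapMaybe strengthen (map (ren (ext ρ)) H)         ≡⟨ mapMaybe-map strengthen (ren (ext ρ)) H ⟩
  mapMaybe (λ h → strengthen (ren (ext ρ) h)) H     ≡⟨ mapMaybe-cong (strengthen-ren ρ) H ⟩
  mapMaybe (λ h → M.map (ren ρ) (strengthen h)) H   ≡⟨ map-mapMaybe (ren ρ) strengthen H ⟨
  map (ren ρ) (hoisted H)                           ≡⟨ renL-map ρ (hoisted H) ⟨
  renL ρ (hoisted H)                                ∎
  where open ≡-Reasoning

pinned-ren : ∀ (ρ : Fin m → Fin n) H → pinned (renL (ext ρ) H) ≡ renL (ext ρ) (pinned H)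
pinned-ren ρ H = begin
  pinned (renL (ext ρ) H)                                ≡⟨ cong pinned (renL-map (ext ρ) H) ⟩
  pinned (map (ren (ext ρ)) H)                           ≡⟨ mapMaybe-map _ (ren (ext ρ)) H ⟩
  mapMaybe (λ h → whenNothing (strengthen (ren (ext ρ) h)) (ren (ext ρ) h)) H
    ≡⟨ mapMaybe-cong whenNothing-strengthen-ren H ⟩
  mapMaybe (λ h → M.map (ren (ext ρ)) (whenNothing (strengthen h) h)) H
    ≡⟨ map-mapMaybe (ren (ext ρ)) _ H ⟨
  map (ren (ext ρ)) (pinned H)                           ≡⟨ renL-map (ext ρ) (pinned H) ⟨
  renL (ext ρ) (pinned H)                                ∎
  where
  open ≡-Reasoning

  whenNothing-strengthen-ren : ∀ h → whenNothing (strengthen (ren (ext ρ) h)) (ren (ext ρ) h)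
                                   ≡ M.map (ren (ext ρ)) (whenNothing (strengthen h) h)
  whenNothing-strengthen-ren h =
    trans (cong (λ m → whenNothing m (ren (ext ρ) h)) (strengthen-ren ρ h))
          (whenNothing-map (ren ρ) (ren (ext ρ)) (strengthen h) h)

quantify-ren : ∀ (ρ : Fin m → Fin n) p → quantify (ren (ext ρ) p) ≡ ren ρ (quantify p)
quantify-ren ρ (H ⇛ t) = cong₂ (λ G K → G ⇛ ∀ᵖ (K ⇛ renᵗ (ext ρ) t)) (hoisted-ren ρ H) (pinned-ren ρ H)

assume-ren : ∀ (ρ : Fin m → Fin n) G p → assume (map (ren ρ) G) (ren ρ p) ≡ ren ρ (assume G p)
assume-ren ρ G (H ⇛ t) = cong (_⇛ renᵗ ρ t) (begin
  map (ren ρ) G ++ renL ρ H         ≡⟨ cong (map (ren ρ) G ++_) (renL-map ρ H) ⟩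
  map (ren ρ) G ++ map (ren ρ) H    ≡⟨ map-++ (ren ρ) G H ⟨
  map (ren ρ) (G ++ H)              ≡⟨ renL-map ρ (G ++ H) ⟨
  renL ρ (G ++ H)                   ∎)
  where open ≡-Reasoning

nf-ren : ∀ (ρ : Fin m → Fin n) A → toList (nf (rename ρ A)) ≡ map (ren ρ) (toList (nf A))
nf-ren ρ (var i) = refl
nf-ren ρ (A ⇒ B) = begin
  map (assume (toList (nf (rename ρ A)))) (toList (nf (rename ρ B)))
    ≡⟨ cong₂ (λ G K → map (assume G) K) (nf-ren ρ A) (nf-ren ρ B) ⟩
  map (assume (map (ren ρ) (toList (nf A)))) (map (ren ρ) (toList (nf B)))
    ≡⟨ map-∘-commute (assume-ren ρ (toList (nf A))) (toList (nf B)) ⟩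
  map (ren ρ) (map (assume (toList (nf A))) (toList (nf B)))
    ∎
  where open ≡-Reasoning
nf-ren ρ (A ∧ B) =
  trans (cong₂ _++_ (nf-ren ρ A) (nf-ren ρ B)) (sym (map-++ (ren ρ) (toList (nf A)) (toList (nf B))))
nf-ren ρ (∀' A)  =
  trans (cong (map quantify) (nf-ren (ext ρ) A)) (map-∘-commute (quantify-ren ρ) (toList (nf A)))

hoisted-wk : ∀ (G : List (Prime n)) H → hoisted (map (ren suc) G ++ H) ≡ G ++ hoisted H
hoisted-wk G H = begin
  hoisted (map (ren suc) G ++ H)
    ≡⟨ mapMaybe-++ strengthen (map (ren suc) G) H ⟩
  hoisted (map (ren suc) G) ++ hoisted H
    ≡⟨ cong (_++ hoisted H) (mapMaybe-map strengthen (ren suc) G) ⟩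
  mapMaybe (λ g → strengthen (ren suc g)) G ++ hoisted H
    ≡⟨ cong (_++ hoisted H) (mapMaybe-cong strengthen-wk G) ⟩
  mapMaybe just G ++ hoisted H
    ≡⟨ cong (_++ hoisted H) (mapMaybe-just G) ⟩
  G ++ hoisted H
    ∎
  where open ≡-Reasoning

pinned-wk : ∀ (G : List (Prime n)) H → pinned (map (ren suc) G ++ H) ≡ pinned H
pinned-wk G H = begin
  pinned (map (ren suc) G ++ H)
    ≡⟨ mapMaybe-++ _ (map (ren suc) G) H ⟩
  pinned (map (ren suc) G) ++ pinned H
    ≡⟨ cong (_++ pinned H) (mapMaybe-map _ (ren suc) G) ⟩
  mapMaybe (λ g → whenNothing (strengthen (ren suc g)) (ren suc g)) G ++ pinned H
    ≡⟨ cong (_++ pinned H) (mapMaybe-cong strengthen-wk-fails G) ⟩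
  mapMaybe (λ _ → nothing) G ++ pinned H
    ≡⟨ cong (_++ pinned H) (mapMaybe-nothing G) ⟩
  pinned H
    ∎
  where
  open ≡-Reasoning

  strengthen-wk-fails : ∀ g → whenNothing (strengthen (ren suc g)) (ren suc g) ≡ nothing
  strengthen-wk-fails g = cong (λ m → whenNothing m (ren suc g)) (strengthen-wk g)

quantify-assume-wk : ∀ (G : List (Prime n)) p → quantify (assume (map (ren suc) G) p) ≡ assume G (quantify p)
quantify-assume-wk G (H ⇛ t) = cong₂ (λ K L → K ⇛ ∀ᵖ (L ⇛ t)) (hoisted-wk G H) (pinned-wk G H)

nf-cong : {A B : Ty n} → A ≅ B → toList (nf A) ≈ toList (nf B)
nf-cong {A = A} refl≅ = ≈-refl (toList (nf A))
nf-cong (sym≅ e)      = ≈-sym (nf-cong e)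
nf-cong (trans≅ e f)  = ≈-trans (nf-cong e) (nf-cong f)
nf-cong (⇒-cong e f)  = Perm-map _ _ (assume-cong (nf-cong e)) (nf-cong f)
nf-cong (∧-cong e f)  = Perm-++ (nf-cong e) (nf-cong f)
nf-cong (∀-cong e)    = Perm-map _ _ quantify-cong (nf-cong e)
nf-cong (comm {A = A} {B}) = Perm-++-comm ~-refl (toList (nf A)) (toList (nf B))
nf-cong (asso {A = A} {B} {C}) = ≈-reflexive (sym (++-assoc (toList (nf A)) (toList (nf B)) (toList (nf C))))
nf-cong (dist {A = A} {B} {C}) = ≈-reflexive (map-++ (assume (toList (nf A))) (toList (nf B)) (toList (nf C)))
nf-cong (curry {A = A} {B} {C}) =
  ≈-reflexive (trans (map-cong assume-++ (toList (nf C))) (map-∘ (toList (nf C))))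
  where
  assume-++ : ∀ p → assume (toList (nf A) ++ toList (nf B)) p
                  ≡ assume (toList (nf A)) (assume (toList (nf B)) p)
  assume-++ (H ⇛ t) = cong (_⇛ t) (++-assoc (toList (nf A)) (toList (nf B)) H)
nf-cong (p-comm {A = A} {B}) = ≈-reflexive (begin
  map quantify (map (assume (toList (nf (wk A)))) (toList (nf B)))
    ≡⟨ cong (λ G → map quantify (map (assume G) (toList (nf B)))) (nf-ren suc A) ⟩
  map quantify (map (assume (map (ren suc) (toList (nf A)))) (toList (nf B)))
    ≡⟨ map-∘-commute (quantify-assume-wk (toList (nf A))) (toList (nf B)) ⟩
  map (assume (toList (nf A))) (map quantify (toList (nf B)))
    ∎)
  where open ≡-Reasoning
nf-cong (p-dist {A = A} {B}) = ≈-reflexive (map-++ quantify (toList (nf A)) (toList (nf B)))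

-- Reading normal forms back as types

infixr 6 _⇒⋆_

mutual
  ⟦_⟧ : Prime n → Ty n
  ⟦ H ⇛ t ⟧ = H ⇒⋆ ⟦ t ⟧ᵗ

  _⇒⋆_ : List (Prime n) → Ty n → Ty n
  []      ⇒⋆ r = r
  (h ∷ H) ⇒⋆ r = ⟦ h ⟧ ⇒ H ⇒⋆ r

  ⟦_⟧ᵗ : Tail n → Ty n
  ⟦ atom i ⟧ᵗ = var i
  ⟦ ∀ᵖ p ⟧ᵗ   = ∀' ⟦ p ⟧

⋀ : Prime n → List (Prime n) → Ty n
⋀ p []       = ⟦ p ⟧
⋀ p (q ∷ qs) = ⟦ p ⟧ ∧ ⋀ q qs

⟦_⟧⁺ : List⁺ (Prime n) → Ty n
⟦ p ∷ ps ⟧⁺ = ⋀ p ps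

⟦⟧⁺-toList : ∀ (P Q : List⁺ (Prime n)) → toList P ≡ toList Q → ⟦ P ⟧⁺ ≡ ⟦ Q ⟧⁺
⟦⟧⁺-toList (p ∷ ps) (p ∷ ps) refl = refl

⇒⋆-++ : ∀ (G H : List (Prime n)) r → (G ++ H) ⇒⋆ r ≡ G ⇒⋆ H ⇒⋆ r
⇒⋆-++ []      H r = refl
⇒⋆-++ (g ∷ G) H r = cong (⟦ g ⟧ ⇒_) (⇒⋆-++ G H r)

mutual
  ⟦⟧-ren : ∀ (ρ : Fin m → Fin n) p → ⟦ ren ρ p ⟧ ≡ rename ρ ⟦ p ⟧
  ⟦⟧-ren ρ (H ⇛ t) = ⇒⋆-ren ρ H (⟦⟧ᵗ-ren ρ t)

  ⇒⋆-ren : ∀ (ρ : Fin m → Fin n) H {r r'} → r' ≡ rename ρ r → renL ρ H ⇒⋆ r' ≡ rename ρ (H ⇒⋆ r)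
  ⇒⋆-ren ρ []      e = e
  ⇒⋆-ren ρ (h ∷ H) e = cong₂ _⇒_ (⟦⟧-ren ρ h) (⇒⋆-ren ρ H e)

  ⟦⟧ᵗ-ren : ∀ (ρ : Fin m → Fin n) t → ⟦ renᵗ ρ t ⟧ᵗ ≡ rename ρ ⟦ t ⟧ᵗ
  ⟦⟧ᵗ-ren ρ (atom i) = refl
  ⟦⟧ᵗ-ren ρ (∀ᵖ p)   = cong ∀' (⟦⟧-ren (ext ρ) p)

≡⇒≅ : {A B : Ty n} → A ≡ B → A ≅ B
≡⇒≅ refl = refl≅

module ≅-Reasoning {n : ℕ} where
  import Relation.Binary.Reasoning.Base.Single (_≅_ {n}) refl≅ trans≅ as Single
  open Single public using (begin_; step-≡-⟩; _∎)
  open ≃-syntax Single._IsRelatedTo_ Single._IsRelatedTo_ Single.∼-go sym≅ public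

⇒-exchange : {a b r : Ty n} → (a ⇒ b ⇒ r) ≅ (b ⇒ a ⇒ r)
⇒-exchange = trans≅ (sym≅ curry) (trans≅ (⇒-cong comm refl≅) curry)

∧-exchange : {a b c : Ty n} → (a ∧ b ∧ c) ≅ (b ∧ a ∧ c)
∧-exchange = trans≅ asso (trans≅ (∧-cong comm refl≅) (sym≅ asso))

⇒⋆-congʳ : ∀ (H : List (Prime n)) {r r'} → r ≅ r' → H ⇒⋆ r ≅ H ⇒⋆ r'
⇒⋆-congʳ []      e = e
⇒⋆-congʳ (h ∷ H) e = ⇒-cong refl≅ (⇒⋆-congʳ H e)

⇒⋆-Select : ∀ {y : Prime n} {H H'} r → Select y H H' → H ⇒⋆ r ≅ ⟦ y ⟧ ⇒ H' ⇒⋆ r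
⇒⋆-Select r here      = refl≅
⇒⋆-Select r (there s) = trans≅ (⇒-cong refl≅ (⇒⋆-Select r s)) ⇒-exchange

⋀-Select : ∀ {y c d : Prime n} {cs ds} → Select y (c ∷ cs) (d ∷ ds) → ⋀ c cs ≅ ⟦ y ⟧ ∧ ⋀ d ds
⋀-Select here                              = refl≅
⋀-Select (there {ys = _ ∷ _} {[]}    here) = comm
⋀-Select (there {ys = _ ∷ _} {_ ∷ _} s)    = trans≅ (∧-cong refl≅ (⋀-Select s)) ∧-exchange

mutual
  ~-sound : {p q : Prime n} → p ~ q → ⟦ p ⟧ ≅ ⟦ q ⟧
  ~-sound (⇛-cong h t) = ≈-sound h (~ᵗ-sound t)

  ~ᵗ-sound : {t u : Tail n} → t ~ᵗ u → ⟦ t ⟧ᵗ ≅ ⟦ u ⟧ᵗ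
  ~ᵗ-sound atom   = refl≅
  ~ᵗ-sound (∀ᵖ r) = ∀-cong (~-sound r)

  ≈-sound : ∀ {H H' : List (Prime n)} {r r'} → H ≈ H' → r ≅ r' → H ⇒⋆ r ≅ H' ⇒⋆ r'
  ≈-sound []           e = e
  ≈-sound (cons x s p) e = trans≅ (⇒-cong (~-sound x) (≈-sound p e)) (sym≅ (⇒⋆-Select _ s))

⟦⁺++⁺⟧ : ∀ (P Q : List⁺ (Prime n)) → ⟦ P ⁺++⁺ Q ⟧⁺ ≅ ⟦ P ⟧⁺ ∧ ⟦ Q ⟧⁺
⟦⁺++⁺⟧ (p ∷ ps) (q ∷ qs) = ⋀-++ p ps
  where
  ⋀-++ : ∀ p ps → ⋀ p (ps ++ q ∷ qs) ≅ ⋀ p ps ∧ ⋀ q qs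
  ⋀-++ p []        = refl≅
  ⋀-++ p (p' ∷ ps) = trans≅ (∧-cong refl≅ (⋀-++ p' ps)) asso

⟦⟧⁺-curry : ∀ (G : List⁺ (Prime n)) r → (⟦ G ⟧⁺ ⇒ r) ≅ toList G ⇒⋆ r
⟦⟧⁺-curry (g ∷ gs) r = ⋀-curry g gs
  where
  ⋀-curry : ∀ g gs → (⋀ g gs ⇒ r) ≅ (g ∷ gs) ⇒⋆ r
  ⋀-curry g []        = refl≅
  ⋀-curry g (g' ∷ gs) = trans≅ curry (⇒-cong refl≅ (⋀-curry g' gs))

assume-sound : ∀ (G : List⁺ (Prime n)) p → (⟦ G ⟧⁺ ⇒ ⟦ p ⟧) ≅ ⟦ assume (toList G) p ⟧
assume-sound G (H ⇛ t) = trans≅ (⟦⟧⁺-curry G (H ⇒⋆ ⟦ t ⟧ᵗ)) (≡⇒≅ (sym (⇒⋆-++ (toList G) H ⟦ t ⟧ᵗ)))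

⇒-⟦⟧⁺ : ∀ (G P : List⁺ (Prime n)) → (⟦ G ⟧⁺ ⇒ ⟦ P ⟧⁺) ≅ ⟦ map⁺ (assume (toList G)) P ⟧⁺
⇒-⟦⟧⁺ G (p ∷ ps) = ⇒-⋀ p ps
  where
  ⇒-⋀ : ∀ p ps → (⟦ G ⟧⁺ ⇒ ⋀ p ps) ≅ ⋀ (assume (toList G) p) (map (assume (toList G)) ps)
  ⇒-⋀ p []       = assume-sound G p
  ⇒-⋀ p (q ∷ qs) = trans≅ dist (∧-cong (assume-sound G p) (⇒-⋀ q qs))

⇒⋆-hoist : ∀ (H : List (Prime n)) {a r} → (a ⇒ H ⇒⋆ r) ≅ H ⇒⋆ (a ⇒ r)
⇒⋆-hoist []      = refl≅
⇒⋆-hoist (h ∷ H) = trans≅ ⇒-exchange (⇒-cong refl≅ (⇒⋆-hoist H))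

⇒⋆-partition : ∀ (H : List (Prime (suc n))) r → H ⇒⋆ r ≅ map (ren suc) (hoisted H) ⇒⋆ pinned H ⇒⋆ r
⇒⋆-partition []      r = refl≅
⇒⋆-partition (h ∷ H) r with strengthen h in e
... | just h' rewrite strengthen-just {p = h} e = ⇒-cong refl≅ (⇒⋆-partition H r)
... | nothing = trans≅ (⇒-cong refl≅ (⇒⋆-partition H r)) (⇒⋆-hoist (map (ren suc) (hoisted H)))

∀-⇒⋆ : ∀ (G : List (Prime n)) r → ∀' (map (ren suc) G ⇒⋆ r) ≅ G ⇒⋆ ∀' r
∀-⇒⋆ []      r = refl≅
∀-⇒⋆ (g ∷ G) r rewrite ⟦⟧-ren suc g = trans≅ p-comm (⇒-cong refl≅ (∀-⇒⋆ G r))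

quantify-sound : (p : Prime (suc n)) → ∀' ⟦ p ⟧ ≅ ⟦ quantify p ⟧
quantify-sound (H ⇛ t) = trans≅ (∀-cong (⇒⋆-partition H ⟦ t ⟧ᵗ)) (∀-⇒⋆ (hoisted H) _)

∀-⟦⟧⁺ : (P : List⁺ (Prime (suc n))) → ∀' ⟦ P ⟧⁺ ≅ ⟦ map⁺ quantify P ⟧⁺
∀-⟦⟧⁺ (p ∷ ps) = ∀-⋀ p ps
  where
  ∀-⋀ : ∀ p ps → ∀' (⋀ p ps) ≅ ⋀ (quantify p) (map quantify ps)
  ∀-⋀ p []       = quantify-sound p
  ∀-⋀ p (q ∷ qs) = trans≅ p-dist (∧-cong (quantify-sound p) (∀-⋀ q qs))

nf-complete : (A : Ty n) → A ≅ ⟦ nf A ⟧⁺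
nf-complete (var i) = refl≅
nf-complete (A ⇒ B) = trans≅ (⇒-cong (nf-complete A) (nf-complete B)) (⇒-⟦⟧⁺ (nf A) (nf B))
nf-complete (A ∧ B) = trans≅ (∧-cong (nf-complete A) (nf-complete B)) (sym≅ (⟦⁺++⁺⟧ (nf A) (nf B)))
nf-complete (∀' A)  = trans≅ (∀-cong (nf-complete A)) (∀-⟦⟧⁺ (nf A))

-- Matching the factors of ∀X.A with those of B ⇒ C

module _ {n : ℕ} (B : Ty n) where

  Factorises : Prime (suc n) → Prime n → Set
  Factorises a c = Σ (Ty (suc n)) λ D → (⟦ c ⟧ ≅ ∀' D) × (⟦ a ⟧ ≅ (wk B ⇒ D))

  wk-complete : wk B ≅ ⟦ map⁺ (ren suc) (nf B) ⟧⁺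
  wk-complete =
    trans≅ (nf-complete (wk B)) (≡⇒≅ (⟦⟧⁺-toList (nf (wk B)) (map⁺ (ren suc) (nf B)) (nf-ren suc B)))

  quantify-factorises : ∀ {a c} → quantify a ~ assume (toList (nf B)) c → Factorises a c
  quantify-factorises {Ha ⇛ ta} {Hc ⇛ ∀ᵖ q} (⇛-cong h (∀ᵖ r)) = D , c≅∀D , a≅B⇒D
    where
    bs : List (Prime (suc n))
    bs = map (ren suc) (toList (nf B))

    R D : Ty (suc n)
    R = ⟦ pinned Ha ⇛ ta ⟧
    D = map (ren suc) Hc ⇒⋆ R

    c≅∀D : Hc ⇒⋆ ∀' ⟦ q ⟧ ≅ ∀' D
    c≅∀D = trans≅ (⇒⋆-congʳ Hc (∀-cong (sym≅ (~-sound r)))) (sym≅ (∀-⇒⋆ Hc R))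

    hoisted≈ : map (ren suc) (hoisted Ha) ≈ bs ++ map (ren suc) Hc
    hoisted≈ = subst (map (ren suc) (hoisted Ha) ≈_) (map-++ (ren suc) (toList (nf B)) Hc)
                     (Perm-map (ren suc) (ren suc) (ren-cong suc) h)

    a≅B⇒D : Ha ⇒⋆ ⟦ ta ⟧ᵗ ≅ (wk B ⇒ D)
    a≅B⇒D = begin
      Ha ⇒⋆ ⟦ ta ⟧ᵗ                               ≃⟨ ⇒⋆-partition Ha ⟦ ta ⟧ᵗ ⟩
      map (ren suc) (hoisted Ha) ⇒⋆ R              ≃⟨ ≈-sound hoisted≈ refl≅ ⟩
      (bs ++ map (ren suc) Hc) ⇒⋆ R                ≡⟨ ⇒⋆-++ bs (map (ren suc) Hc) R ⟩
      bs ⇒⋆ D                                      ≃⟨ ⟦⟧⁺-curry (map⁺ (ren suc) (nf B)) D ⟨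
      ⟦ map⁺ (ren suc) (nf B) ⟧⁺ ⇒ D               ≃⟨ ⇒-cong wk-complete refl≅ ⟨
      wk B ⇒ D                                     ∎
      where open ≅-Reasoning

  ⋀-factorises : ∀ {a as c cs} → Perm Factorises (a ∷ as) (c ∷ cs)
               → Σ (Ty (suc n)) λ C' → (⋀ c cs ≅ ∀' C') × (⋀ a as ≅ (wk B ⇒ C'))
  ⋀-factorises {as = []}    (cons f here []) = f
  ⋀-factorises {as = _ ∷ _} (cons (D , c≅∀D , a≅B⇒D) s p) with Perm-∷-target p
  ... | _ , _ , refl with ⋀-factorises p
  ...   | C' , cs≅∀C' , as≅B⇒C' =
    D ∧ C' , trans≅ (⋀-Select s) (trans≅ (∧-cong c≅∀D cs≅∀C') (sym≅ p-dist))
           , trans≅ (∧-cong a≅B⇒D as≅B⇒C') (sym≅ dist)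

mainTheorem9 : ∀ {n : ℕ} (A : Ty (suc n)) (B C : Ty n)
    → ∀' A ≅ (B ⇒ C)
    → Σ (Ty (suc n)) (λ C' → (C ≅ ∀' C') × (A ≅ (wk B ⇒ C')))
mainTheorem9 A B C ∀A≅B⇒C =
  let C' , nfC≅∀C' , nfA≅B⇒C' = ⋀-factorises B matching
  in  C' , trans≅ (nf-complete C) nfC≅∀C' , trans≅ (nf-complete A) nfA≅B⇒C'
  where
  matching : Perm (Factorises B) (toList (nf A)) (toList (nf C))
  matching = Perm-map⁻ quantify (assume (toList (nf B))) (quantify-factorises B) (nf-cong ∀A≅B⇒C)
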